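{- For integers $n\geq 1$ and $m\geq n$ with $(n,m)\notin\{(1,1),(1,2)\}$, $$\gamma_{\times 2,t}(K_n\Box K_m)=\begin{cases}3 & \text{if } n=1 \text{ and } m\geq 3,\\ 2n & \text{if } n\geq 2 \text{ and } m\geq \lfloor (5n-4)/3\rfloor+1,\\ \lceil 3(n+m)/4\rceil+1 & \text{if } m\leq \lfloor (5n-4)/3\rfloor \text{ and } m\equiv 3n+4 \pmod 8,\\ \lceil 3(n+m)/4\rceil & \text{otherwise.}\end{cases}$$ Hence, for $n\geq 2$, $\gamma_{\times 2,t}(K_n\Box K_n)=\lceil 3n/2\rceil+1$ if $n\equiv 2\pmod 4$, and $\gamma_{\times 2,t}(K_n\Box K_n)=\lceil 3n/2\rceil$ otherwise.
   Context: $K_n$ is the complete graph on $n$ vertices and $K_n\Box K_m$ is the Cartesian product (the $n\times m$ rook's graph): vertex set $V(K_n)\times V(K_m)$, two distinct vertices adjacent iff they agree in exactly one coordinate. A $2$-tuple total dominating set of a graph is a set $S$ of vertices such that every vertex has at least $2$ neighbors in $S$; $\gamma_{\times 2,t}$ denotes the minimum size of such a set. -}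

module Defs where

open import Data.Nat using (ℕ; zero; suc; _+_; _≤_)
open import Data.Bool using (Bool; true; false; if_then_else_; _xor_; _∧_)
open import Data.Fin using (Fin; _≟_)
open import Data.Product using (_×_; _,_; Σ-syntax)
open import Relation.Nullary using (does)
open import Relation.Binary.PropositionalEquality using (_≡_)

countF : {k : ℕ} → (Fin k → Bool) → ℕ
countF {zero}  p = 0
countF {suc k} p = (if p Fin.zero then 1 else 0) + countF (λ i → p (Fin.suc i))
  where import Data.Fin as Fin

VSet : ℕ → ℕ → Set
VSet n m = Fin n → Fin m → Bool

∣_∣ᵥ : {n m : ℕ} → VSet n m → ℕ
∣_∣ᵥ {n} {m} S = sumF (λ i → countF (S i))
  where
  sumF : {k : ℕ} → (Fin k → ℕ) → ℕ
  sumF {zero} f = 0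
  sumF {suc k} f = f Fin.zero + sumF (λ i → f (Fin.suc i))
    where import Data.Fin as Fin

-- adjacency in the rook's graph K_n □ K_m: agree in exactly one coordinate
adj : {n m : ℕ} → Fin n × Fin m → Fin n × Fin m → Bool
adj (a , b) (i , j) = does (a ≟ i) xor does (b ≟ j)

nbrsIn : {n m : ℕ} → VSet n m → Fin n × Fin m → ℕ
nbrsIn S v = ∣ (λ i j → adj v (i , j) ∧ S i j) ∣ᵥ

IsDoubleTotalDom : {n m : ℕ} → VSet n m → Set
IsDoubleTotalDom {n} {m} S = (v : Fin n × Fin m) → 2 ≤ nbrsIn S v

Gamma×2t : ℕ → ℕ → ℕ → Set
Gamma×2t n m k =
  (Σ[ S ∈ VSet n m ] (IsDoubleTotalDom S × ∣ S ∣ᵥ ≡ k))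
  × ((S : VSet n m) → IsDoubleTotalDom S → k ≤ ∣ S ∣ᵥ)

-- A vertex (a, b) has r_a + c_b − 2[(a, b) ∈ S] neighbours in S, where r_a and c_b count the vertices of
-- S in row a and column b; so S is a 2-tuple total dominating set iff r_a + c_b ≥ 2 + 2[(a, b) ∈ S]. An empty row forces two vertices in every column, and an empty column two in every row, so
-- |S| ≥ 2n. Otherwise a discharging argument gives 4|S| ≥ 3(n + m), with equality only if 8A + 3m = 9n for
-- some A; when m ≡ 3n + 4 (mod 8) this is impossible while 4 | n + m, so |S| ≥ ⌈3(n + m)/4⌉ + 1 there. A
-- single row needs three vertices. Full columns give 2n (3 for n = 1). A "spider" with p hub rows and q hub columns has
-- n + m − (p + q) vertices, and for n ≥ 11 the split p + q = ⌊(n + m)/4⌋, or one less under the congruence,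
-- fits. The cases n ≤ 10 are settled by computation, the 3 × 3 cross being the only other construction.

module Submission where

open import Defs
open import Data.Nat using (ℕ; _+_; _*_; _∸_; _≤_; _<_; _/_; _%_)
open import Data.Product using (_×_)
open import Relation.Nullary using (¬_)
open import Relation.Binary.PropositionalEquality using (_≡_)

open import Data.Bool using (Bool; true; false; if_then_else_; _xor_; _∧_; _∨_; not; T)
open import Data.Bool.Properties using (∨-comm; ∨-zeroʳ; T-≡)
open import Data.Fin using (Fin; zero; suc; toℕ; fromℕ<; _≟_)
open import Data.Fin.Properties using (any?; all?; toℕ-fromℕ<)
open import Data.List using ([]; _∷_)
open import Data.Maybe using (Maybe; just; nothing; is-just; _<∣>_; to-witness-T)
open import Data.Nat using (zero; suc; z≤n; s≤s; s≤s⁻¹; _<ᵇ_; _≡ᵇ_; _⊓_; NonZero)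
open import Data.Nat.DivMod
open import Data.Nat.Divisibility using (_∣_; divides; divides-refl; ∣m+n∣m⇒∣n; ∣n⇒∣m*n)
open import Data.Nat.Properties hiding (_≟_)
open import Data.Nat.Properties using () renaming (_≟_ to _≟ℕ_)
open import Data.Nat.Tactic.RingSolver using (solve)
open import Data.Product using (_,_; ∃-syntax; Σ-syntax; proj₁; proj₂)
open import Data.Sum using (_⊎_; inj₁; inj₂)
open import Data.Unit using (tt)
open import Function using (_∘_; _∋_; _⇔_; mk⇔; Equivalence)
open import Relation.Nullary using (does; yes; no; contradiction)
open import Relation.Nullary.Decidable using (Dec; toWitness; ¬?; _×-dec_; _→-dec_; T?)
open import Relation.Binary.PropositionalEquality
  using (_≢_; refl; sym; trans; cong; cong₂; subst; subst₂; module ≡-Reasoning)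
open import Algebra.Properties.CommutativeSemigroup +-commutativeSemigroup
  using (xy∙z≈xz∙y) renaming (interchange to +-interchange)
open import Algebra.Properties.Semiring.Sum +-*-semiring
  using (sum; sum-syntax; sum-cong-≗; ∑-distrib-+; ∑-comm; *-distribˡ-sum)

𝟙 : Bool → ℕ
𝟙 b = if b then 1 else 0

count≡∑ : {k : ℕ} (p : Fin k → Bool) → countF p ≡ ∑[ i < k ] 𝟙 (p i)
count≡∑ {zero}  p = refl
count≡∑ {suc k} p = cong (𝟙 (p zero) +_) (count≡∑ (p ∘ suc))

count≤ : {k : ℕ} (p : Fin k → Bool) → countF p ≤ k
count≤ {zero}  p = z≤n
count≤ {suc k} p with p zero
... | true  = s≤s (count≤ (p ∘ suc))
... | false = m≤n⇒m≤1+n (count≤ (p ∘ suc))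

count>0⇒∃ : {k : ℕ} (p : Fin k → Bool) → 1 ≤ countF p → ∃[ i ] p i ≡ true
count>0⇒∃ {suc k} p c with p zero in eq
... | true  = zero , eq
... | false = let (i , pi) = count>0⇒∃ (p ∘ suc) c in suc i , pi

∑-mono-≤ : {k : ℕ} {f g : Fin k → ℕ} → (∀ i → f i ≤ g i) → ∑[ i < k ] f i ≤ ∑[ i < k ] g i
∑-mono-≤ {zero}  f≤g = z≤n
∑-mono-≤ {suc k} f≤g = +-mono-≤ (f≤g zero) (∑-mono-≤ (f≤g ∘ suc))

∑-const : (k c : ℕ) → ∑[ i < k ] c ≡ k * c
∑-const zero    c = refl
∑-const (suc k) c = cong (c +_) (∑-const k c)

∑-zero : (k : ℕ) → ∑[ i < k ] 0 ≡ 0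
∑-zero k = trans (∑-const k 0) (*-zeroʳ k)

∑-δ : {k : ℕ} (a : Fin k) (f : Fin k → ℕ) → ∑[ i < k ] (if does (a ≟ i) then f i else 0) ≡ f a
∑-δ {suc k} zero    f = trans (cong (f zero +_) (∑-zero k)) (+-identityʳ (f zero))
∑-δ {suc k} (suc a) f = ∑-δ a (f ∘ suc)

*-count≤∑ : {k : ℕ} (t : ℕ) (p : Fin k → Bool) (f : Fin k → ℕ) {c : ℕ} → countF p ≡ c →
  (∀ i → t * 𝟙 (p i) ≤ f i) → t * c ≤ ∑[ i < k ] f i
*-count≤∑ {k} t p f {c} count≡c bound = begin
  t * c                       ≡⟨ cong (t *_) (trans (sym count≡c) (count≡∑ p)) ⟩
  t * (∑[ i < k ] 𝟙 (p i))    ≡⟨ *-distribˡ-sum t (𝟙 ∘ p) ⟩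
  ∑[ i < k ] (t * 𝟙 (p i))    ≤⟨ ∑-mono-≤ bound ⟩
  ∑[ i < k ] f i              ∎
  where open ≤-Reasoning

∑-linear : {k : ℕ} (u v w : ℕ) (f g h : Fin k → ℕ) →
  ∑[ i < k ] (u * f i + v * g i + w * h i) ≡ u * ∑[ i < k ] f i + v * ∑[ i < k ] g i + w * ∑[ i < k ] h i
∑-linear {k} u v w f g h = begin
  ∑[ i < k ] (u * f i + v * g i + w * h i)
    ≡⟨ ∑-distrib-+ (λ i → u * f i + v * g i) (λ i → w * h i) ⟩
  ∑[ i < k ] (u * f i + v * g i) + ∑[ i < k ] (w * h i)
    ≡⟨ cong (_+ ∑[ i < k ] (w * h i)) (∑-distrib-+ (λ i → u * f i) (λ i → v * g i)) ⟩
  ∑[ i < k ] (u * f i) + ∑[ i < k ] (v * g i) + ∑[ i < k ] (w * h i)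
    ≡⟨ sym (cong₂ _+_ (cong₂ _+_ (*-distribˡ-sum u f) (*-distribˡ-sum v g)) (*-distribˡ-sum w h)) ⟩
  u * ∑[ i < k ] f i + v * ∑[ i < k ] g i + w * ∑[ i < k ] h i ∎
  where open ≡-Reasoning

∑∑-linear : {k l : ℕ} (u v w : ℕ) (f g h : Fin k → Fin l → ℕ) →
  ∑[ i < k ] ∑[ j < l ] (u * f i j + v * g i j + w * h i j)
    ≡ u * ∑[ i < k ] ∑[ j < l ] f i j + v * ∑[ i < k ] ∑[ j < l ] g i j + w * ∑[ i < k ] ∑[ j < l ] h i j
∑∑-linear u v w f g h =
  trans (sum-cong-≗ (λ i → ∑-linear u v w (f i) (g i) (h i)))
        (∑-linear u v w (λ i → sum (f i)) (λ i → sum (g i)) (λ i → sum (h i)))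

-- Degrees in the rook's graph
rowCount : {n m : ℕ} → VSet n m → Fin n → ℕ
rowCount S a = countF (S a)

columnCount : {n m : ℕ} → VSet n m → Fin m → ℕ
columnCount S b = countF (λ a → S a b)

transpose : {n m : ℕ} → VSet n m → VSet m n
transpose S b a = S a b

size≡∑rowCount : {n m : ℕ} (S : VSet n m) → ∣ S ∣ᵥ ≡ ∑[ a < n ] rowCount S a
size≡∑rowCount {zero}  S = refl
size≡∑rowCount {suc n} S = cong (rowCount S zero +_) (size≡∑rowCount (S ∘ suc))

size≡∑∑ : {n m : ℕ} (S : VSet n m) → ∣ S ∣ᵥ ≡ ∑[ a < n ] ∑[ b < m ] 𝟙 (S a b)
size≡∑∑ S = trans (size≡∑rowCount S) (sum-cong-≗ (count≡∑ ∘ S))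

size-transpose : {n m : ℕ} (S : VSet n m) → ∣ transpose S ∣ᵥ ≡ ∣ S ∣ᵥ
size-transpose S = trans (size≡∑∑ (transpose S)) (trans (sym (∑-comm (λ a b → 𝟙 (S a b)))) (sym (size≡∑∑ S)))

size≡∑columnCount : {n m : ℕ} (S : VSet n m) → ∣ S ∣ᵥ ≡ ∑[ b < m ] columnCount S b
size≡∑columnCount S = trans (sym (size-transpose S)) (size≡∑rowCount (transpose S))

𝟙-∧ : ∀ x z → 𝟙 (x ∧ z) ≡ (if x then 𝟙 z else 0)
𝟙-∧ true  z = refl
𝟙-∧ false z = refl

∑-if : {k : ℕ} (x : Bool) (f : Fin k → ℕ) → ∑[ j < k ] (if x then f j else 0) ≡ (if x then ∑[ j < k ] f j else 0)
∑-if {k} true  f = refl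
∑-if {k} false f = ∑-zero k

∑-δ-∧ : {k : ℕ} (a : Fin k) (z : Fin k → Bool) → ∑[ i < k ] 𝟙 (does (a ≟ i) ∧ z i) ≡ 𝟙 (z a)
∑-δ-∧ a z = trans (sum-cong-≗ (λ i → 𝟙-∧ (does (a ≟ i)) (z i))) (∑-δ a (𝟙 ∘ z))

∑∑-δ-∧ : {k l : ℕ} (a : Fin k) (z : Fin k → Fin l → Bool) →
  ∑[ i < k ] ∑[ j < l ] 𝟙 (does (a ≟ i) ∧ z i j) ≡ ∑[ j < l ] 𝟙 (z a j)
∑∑-δ-∧ a z = trans (sum-cong-≗ (λ i → trans (sum-cong-≗ (λ j → 𝟙-∧ (does (a ≟ i)) (z i j)))
                                         (∑-if (does (a ≟ i)) (λ j → 𝟙 (z i j)))))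
                    (∑-δ a (λ i → ∑[ j < _ ] 𝟙 (z i j)))

cell-count : ∀ x y s → 𝟙 ((x xor y) ∧ s) + 2 * 𝟙 (x ∧ (y ∧ s)) ≡ 𝟙 (x ∧ s) + 𝟙 (y ∧ s)
cell-count true  true  true  = refl
cell-count true  true  false = refl
cell-count true  false true  = refl
cell-count true  false false = refl
cell-count false y     s     = +-identityʳ (𝟙 (y ∧ s))

degree-identity : {n m : ℕ} (S : VSet n m) (a : Fin n) (b : Fin m) →
  nbrsIn S (a , b) + 2 * 𝟙 (S a b) ≡ rowCount S a + columnCount S b
degree-identity {n} {m} S a b = begin
  nbrsIn S (a , b) + 2 * 𝟙 (S a b)
    ≡⟨ cong₂ _+_ (size≡∑∑ (λ i j → adj (a , b) (i , j) ∧ S i j)) (sym twice-cell) ⟩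
  ∑∑ (λ i j → 𝟙 ((x i xor y j) ∧ S i j)) + ∑∑ (λ i j → 2 * 𝟙 (x i ∧ (y j ∧ S i j)))
    ≡⟨ sym (∑∑-distrib-+ _ _) ⟩
  ∑∑ (λ i j → 𝟙 ((x i xor y j) ∧ S i j) + 2 * 𝟙 (x i ∧ (y j ∧ S i j)))
    ≡⟨ sum-cong-≗ (λ i → sum-cong-≗ (λ j → cell-count (x i) (y j) (S i j))) ⟩
  ∑∑ (λ i j → 𝟙 (x i ∧ S i j) + 𝟙 (y j ∧ S i j))
    ≡⟨ ∑∑-distrib-+ _ _ ⟩
  ∑∑ (λ i j → 𝟙 (x i ∧ S i j)) + ∑∑ (λ i j → 𝟙 (y j ∧ S i j))
    ≡⟨ cong₂ _+_ row column ⟩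
  rowCount S a + columnCount S b ∎
  where
  open ≡-Reasoning
  x : Fin n → Bool
  x i = does (a ≟ i)
  y : Fin m → Bool
  y j = does (b ≟ j)
  ∑∑ : (Fin n → Fin m → ℕ) → ℕ
  ∑∑ f = ∑[ i < n ] ∑[ j < m ] f i j
  ∑∑-distrib-+ : (f g : Fin n → Fin m → ℕ) → ∑∑ (λ i j → f i j + g i j) ≡ ∑∑ f + ∑∑ g
  ∑∑-distrib-+ f g =
    trans (sum-cong-≗ (λ i → ∑-distrib-+ (f i) (g i))) (∑-distrib-+ (λ i → sum (f i)) (λ i → sum (g i)))
  twice-cell : ∑∑ (λ i j → 2 * 𝟙 (x i ∧ (y j ∧ S i j))) ≡ 2 * 𝟙 (S a b)
  twice-cell = begin
    ∑∑ (λ i j → 2 * 𝟙 (x i ∧ (y j ∧ S i j)))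
      ≡⟨ sum-cong-≗ (λ i → sym (*-distribˡ-sum 2 (λ j → 𝟙 (x i ∧ (y j ∧ S i j))))) ⟩
    ∑[ i < n ] (2 * ∑[ j < m ] 𝟙 (x i ∧ (y j ∧ S i j)))
      ≡⟨ sym (*-distribˡ-sum 2 (λ i → ∑[ j < m ] 𝟙 (x i ∧ (y j ∧ S i j)))) ⟩
    2 * ∑∑ (λ i j → 𝟙 (x i ∧ (y j ∧ S i j)))  ≡⟨ cong (2 *_) (∑∑-δ-∧ a (λ i j → y j ∧ S i j)) ⟩
    2 * ∑[ j < m ] 𝟙 (y j ∧ S a j)            ≡⟨ cong (2 *_) (∑-δ-∧ b (S a)) ⟩
    2 * 𝟙 (S a b)                             ∎
  row : ∑∑ (λ i j → 𝟙 (x i ∧ S i j)) ≡ rowCount S a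
  row = trans (∑∑-δ-∧ a S) (sym (count≡∑ (S a)))
  column : ∑∑ (λ i j → 𝟙 (y j ∧ S i j)) ≡ columnCount S b
  column = trans (∑-comm (λ i j → 𝟙 (y j ∧ S i j)))
                 (trans (∑∑-δ-∧ b (transpose S)) (sym (count≡∑ (λ i → S i b))))

DegreeCondition : {n m : ℕ} → VSet n m → Set
DegreeCondition S = ∀ a b → 2 + 2 * 𝟙 (S a b) ≤ rowCount S a + columnCount S b

doubleTotalDom⇔degreeCondition : {n m : ℕ} (S : VSet n m) → IsDoubleTotalDom S ⇔ DegreeCondition S
doubleTotalDom⇔degreeCondition S = mk⇔
  (λ dom a b → subst (2 + 2 * 𝟙 (S a b) ≤_) (degree-identity S a b) (+-monoˡ-≤ _ (dom (a , b))))
  (λ deg (a , b) → +-cancelʳ-≤ _ 2 _ (subst (2 + 2 * 𝟙 (S a b) ≤_) (sym (degree-identity S a b)) (deg a b)))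

degreeCondition-transpose : {n m : ℕ} (S : VSet n m) → DegreeCondition S → DegreeCondition (transpose S)
degreeCondition-transpose S deg b a = subst (2 + 2 * 𝟙 (S a b) ≤_) (+-comm (rowCount S a) (columnCount S b)) (deg a b)

-- Lower bounds
emptyRow⇒2m≤size : {n m : ℕ} (S : VSet n m) → DegreeCondition S → (a : Fin n) → rowCount S a ≡ 0 → 2 * m ≤ ∣ S ∣ᵥ
emptyRow⇒2m≤size {n} {m} S deg a empty = begin
  2 * m                     ≡⟨ trans (*-comm 2 m) (sym (∑-const m 2)) ⟩
  ∑[ b < m ] 2              ≤⟨ ∑-mono-≤ column≥2 ⟩
  ∑[ b < m ] columnCount S b ≡⟨ sym (size≡∑columnCount S) ⟩
  ∣ S ∣ᵥ                    ∎
  where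
  open ≤-Reasoning
  column≥2 : ∀ b → 2 ≤ columnCount S b
  column≥2 b = ≤-trans (m≤m+n 2 _) (subst (λ r → 2 + 2 * 𝟙 (S a b) ≤ r + columnCount S b) empty (deg a b))

emptyColumn⇒2n≤size : {n m : ℕ} (S : VSet n m) → DegreeCondition S → (b : Fin m) → columnCount S b ≡ 0 → 2 * n ≤ ∣ S ∣ᵥ
emptyColumn⇒2n≤size S deg b empty =
  subst (_ ≤_) (size-transpose S) (emptyRow⇒2m≤size (transpose S) (degreeCondition-transpose S deg) b empty)

singleRow⇒3≤size : {m : ℕ} (S : VSet 1 (suc m)) → DegreeCondition S → 3 ≤ ∣ S ∣ᵥ
singleRow⇒3≤size S deg = subst (3 ≤_) (sym (trans (size≡∑rowCount S) (+-identityʳ r))) 3≤r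
  where
  r : ℕ
  r = rowCount S zero
  r+1≥ : ∀ b → 2 + 2 * 𝟙 (S zero b) ≤ r + 1
  r+1≥ b = ≤-trans (deg zero b) (+-monoʳ-≤ r (count≤ (λ a → S a b)))
  nonempty : 1 ≤ r
  nonempty = +-cancelʳ-≤ 1 1 r (≤-trans (m≤m+n 2 _) (r+1≥ zero))
  3≤r : 3 ≤ r
  3≤r with (b , Sb) ← count>0⇒∃ (S zero) nonempty =
    +-cancelʳ-≤ 1 3 r (subst (λ s → 2 + 2 * 𝟙 s ≤ r + 1) Sb (r+1≥ b))

-- Discharging weights: a vertex of S alone in its row gives that row 6, one alone in its column gives its
-- row 2, any other gives 3; its column receives charge s y x. No vertex is alone in both lines (it would have
-- no neighbour in S), so each vertex gives away 8, or 6 if it is alone in neither line, while every nonempty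
-- row and column collects at least 6.
charge : Bool → Bool → Bool → ℕ
charge s x y = if s then (if x then 6 else if y then 2 else 3) else 0

6≤∑charge : {m : ℕ} (s y : Fin m → Bool) → 1 ≤ countF s →
  (∀ b → s b ≡ true → y b ≡ true → 3 ≤ countF s) →
  6 ≤ ∑[ b < m ] charge (s b) (countF s ≡ᵇ 1) (y b)
6≤∑charge {m} s y nonempty crowded with countF s in eq
... | 1 = *-count≤∑ 6 s (λ b → charge (s b) true (y b)) eq alone
  where
  alone : ∀ b → 6 * 𝟙 (s b) ≤ charge (s b) true (y b)
  alone b with s b
  ... | true  = ≤-refl
  ... | false = z≤n
... | 2 = *-count≤∑ 3 s (λ b → charge (s b) false (y b)) eq pair
  where
  pair : ∀ b → 3 * 𝟙 (s b) ≤ charge (s b) false (y b)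
  pair b with s b in sb | y b in yb
  ... | true  | true  = contradiction (crowded b sb yb) λ { (s≤s (s≤s ())) }
  ... | true  | false = ≤-refl
  ... | false | _     = z≤n
... | suc (suc (suc k)) =
  ≤-trans (*-monoʳ-≤ 2 (s≤s (s≤s (s≤s z≤n)))) (*-count≤∑ 2 s (λ b → charge (s b) false (y b)) eq many)
  where
  many : ∀ b → 2 * 𝟙 (s b) ≤ charge (s b) false (y b)
  many b with s b | y b
  ... | true  | true  = ≤-refl
  ... | true  | false = s≤s (s≤s z≤n)
  ... | false | _     = z≤n

charge-split : ∀ s x y → (s ∧ x ∧ y) ≡ false →
  charge s x y ≡ 6 * 𝟙 (s ∧ x) + 2 * 𝟙 (s ∧ y) + 3 * 𝟙 (s ∧ not x ∧ not y)
  × charge s y x ≡ 2 * 𝟙 (s ∧ x) + 6 * 𝟙 (s ∧ y) + 3 * 𝟙 (s ∧ not x ∧ not y)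
  × 𝟙 s ≡ 1 * 𝟙 (s ∧ x) + 1 * 𝟙 (s ∧ y) + 1 * 𝟙 (s ∧ not x ∧ not y)
charge-split true  true  true  ()
charge-split true  true  false _ = refl , refl , refl
charge-split true  false true  _ = refl , refl , refl
charge-split true  false false _ = refl , refl , refl
charge-split false x     y     _ = refl , refl , refl

charge-bound : ∀ n m A B C → 6 * n ≤ 6 * A + 2 * B + 3 * C → 6 * m ≤ 2 * A + 6 * B + 3 * C →
  3 * (n + m) + C ≤ 4 * (A + B + C)
charge-bound n m A B C rows columns = *-cancelˡ-≤ 2 (begin
  2 * (3 * (n + m) + C)                                  ≡⟨ solve (n ∷ m ∷ A ∷ B ∷ C ∷ []) ⟩
  6 * n + 6 * m + 2 * C                                  ≤⟨ +-monoˡ-≤ (2 * C) (+-mono-≤ rows columns) ⟩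
  6 * A + 2 * B + 3 * C + (2 * A + 6 * B + 3 * C) + 2 * C ≡⟨ solve (n ∷ m ∷ A ∷ B ∷ C ∷ []) ⟩
  2 * (4 * (A + B + C))                                  ∎)
  where open ≤-Reasoning

charge-tight : ∀ n m A B C → 6 * n ≤ 6 * A + 2 * B + 3 * C → 6 * m ≤ 2 * A + 6 * B + 3 * C →
  4 * (A + B + C) ≡ 3 * (n + m) → 8 * A + 3 * m ≡ 9 * n
charge-tight n m A B C rows columns tight = *-cancelˡ-≡ (8 * A + 3 * m) (9 * n) 2 doubled
  where
  R K : ℕ
  R = 6 * A + 2 * B + 3 * C
  K = 2 * A + 6 * B + 3 * C
  C≡0 : C ≡ 0
  C≡0 = n≤0⇒n≡0 (+-cancelˡ-≤ (3 * (n + m)) C 0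
          (≤-trans (charge-bound n m A B C rows columns) (≤-reflexive (trans tight (sym (+-identityʳ _))))))
  R+K≤ : R + K ≤ 6 * n + 6 * m
  R+K≤ = begin
    R + K                 ≤⟨ m≤m+n (R + K) (2 * C) ⟩
    6 * A + 2 * B + 3 * C + (2 * A + 6 * B + 3 * C) + 2 * C ≡⟨ solve (A ∷ B ∷ C ∷ []) ⟩
    2 * (4 * (A + B + C)) ≡⟨ cong (2 *_) tight ⟩
    2 * (3 * (n + m))     ≡⟨ solve (n ∷ m ∷ []) ⟩
    6 * n + 6 * m         ∎
    where open ≤-Reasoning
  rows≡ : 6 * n ≡ R
  rows≡ = ≤-antisym rows (+-cancelʳ-≤ K R (6 * n) (≤-trans R+K≤ (+-monoʳ-≤ (6 * n) columns)))
  columns≡ : 6 * m ≡ K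
  columns≡ = ≤-antisym columns (+-cancelˡ-≤ (6 * n) K (6 * m) (subst (λ r → r + K ≤ 6 * n + 6 * m) (sym rows≡) R+K≤))
  doubled : 2 * (8 * A + 3 * m) ≡ 2 * (9 * n)
  doubled = begin
    2 * (8 * A + 3 * m)                ≡⟨ solve (A ∷ m ∷ []) ⟩
    16 * A + 6 * m                     ≡⟨ cong (16 * A +_) columns≡ ⟩
    16 * A + (2 * A + 6 * B + 3 * C)   ≡⟨ cong (λ c → 16 * A + (2 * A + 6 * B + 3 * c)) C≡0 ⟩
    16 * A + (2 * A + 6 * B + 3 * 0)   ≡⟨ solve (A ∷ B ∷ []) ⟩
    3 * (6 * A + 2 * B + 3 * 0)        ≡⟨ cong (λ c → 3 * (6 * A + 2 * B + 3 * c)) (sym C≡0) ⟩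
    3 * R                              ≡⟨ cong (3 *_) (sym rows≡) ⟩
    3 * (6 * n)                        ≡⟨ solve (n ∷ []) ⟩
    2 * (9 * n)                        ∎
    where open ≡-Reasoning

ChargeBound : ℕ → ℕ → ℕ → Set
ChargeBound n m k = 3 * (n + m) ≤ 4 * k × (4 * k ≡ 3 * (n + m) → ∃[ A ] 8 * A + 3 * m ≡ 9 * n)

≡ᵇ1⇒≡1 : ∀ k → (k ≡ᵇ 1) ≡ true → k ≡ 1
≡ᵇ1⇒≡1 1 _ = refl
≡ᵇ1⇒≡1 0 ()
≡ᵇ1⇒≡1 (suc (suc k)) ()

discharging : {n m : ℕ} (S : VSet n m) → DegreeCondition S →
  (∀ a → 1 ≤ rowCount S a) → (∀ b → 1 ≤ columnCount S b) → ChargeBound n m ∣ S ∣ᵥ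
discharging {n} {m} S deg nonemptyRow nonemptyColumn =
  subst (λ k → 3 * (n + m) ≤ 4 * k) (sym size≡)
    (≤-trans (m≤m+n _ C) (charge-bound n m A B C rowCharges columnCharges)) ,
  λ tight → A , charge-tight n m A B C rowCharges columnCharges (subst (λ k → 4 * k ≡ 3 * (n + m)) size≡ tight)
  where
  x : Fin n → Bool
  x a = rowCount S a ≡ᵇ 1
  y : Fin m → Bool
  y b = columnCount S b ≡ᵇ 1
  ∑∑ : (Fin n → Fin m → ℕ) → ℕ
  ∑∑ f = ∑[ a < n ] ∑[ b < m ] f a b
  α β γ : Fin n → Fin m → ℕ
  α a b = 𝟙 (S a b ∧ x a)
  β a b = 𝟙 (S a b ∧ y b)
  γ a b = 𝟙 (S a b ∧ not (x a) ∧ not (y b))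
  A B C : ℕ
  A = ∑∑ α
  B = ∑∑ β
  C = ∑∑ γ
  not-both : ∀ a b → (S a b ∧ x a ∧ y b) ≡ false
  not-both a b with S a b in sab | x a in xa | y b in yb
  ... | true  | true  | true  = contradiction
    (subst₂ (λ r c → 2 + 2 * 𝟙 (S a b) ≤ r + c) (≡ᵇ1⇒≡1 (rowCount S a) xa) (≡ᵇ1⇒≡1 (columnCount S b) yb) (deg a b))
    (subst (λ s → ¬ (2 + 2 * 𝟙 s ≤ 2)) (sym sab) λ { (s≤s (s≤s ())) })
  ... | true  | true  | false = refl
  ... | true  | false | _     = refl
  ... | false | _     | _     = refl
  cell : ∀ a b → charge (S a b) (x a) (y b) ≡ 6 * α a b + 2 * β a b + 3 * γ a b
               × charge (S a b) (y b) (x a) ≡ 2 * α a b + 6 * β a b + 3 * γ a b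
               × 𝟙 (S a b) ≡ 1 * α a b + 1 * β a b + 1 * γ a b
  cell a b = charge-split (S a b) (x a) (y b) (not-both a b)
  cellwise : {f g : Fin n → Fin m → ℕ} → (∀ a b → f a b ≡ g a b) → ∑∑ f ≡ ∑∑ g
  cellwise f≡g = sum-cong-≗ (λ a → sum-cong-≗ (f≡g a))
  3≤ : ∀ {r c} s → 2 + 2 * 𝟙 s ≤ r + c → s ≡ true → (c ≡ᵇ 1) ≡ true → 3 ≤ r
  3≤ {r} {c} s le refl c≡1 = +-cancelʳ-≤ 1 3 r (subst (λ c → 4 ≤ r + c) (≡ᵇ1⇒≡1 c c≡1) le)
  rowCharges : 6 * n ≤ 6 * A + 2 * B + 3 * C
  rowCharges = begin
    6 * n                                        ≡⟨ trans (*-comm 6 n) (sym (∑-const n 6)) ⟩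
    ∑[ a < n ] 6                                 ≤⟨ ∑-mono-≤ (λ a → 6≤∑charge (S a) y (nonemptyRow a)
                                                      (λ b → 3≤ (S a b) (deg a b))) ⟩
    ∑∑ (λ a b → charge (S a b) (x a) (y b))      ≡⟨ cellwise (λ a b → proj₁ (cell a b)) ⟩
    ∑∑ (λ a b → 6 * α a b + 2 * β a b + 3 * γ a b)
                                                 ≡⟨ ∑∑-linear 6 2 3 α β γ ⟩
    6 * A + 2 * B + 3 * C                        ∎
    where open ≤-Reasoning
  columnCharges : 6 * m ≤ 2 * A + 6 * B + 3 * C
  columnCharges = begin
    6 * m                                        ≡⟨ trans (*-comm 6 m) (sym (∑-const m 6)) ⟩
    ∑[ b < m ] 6                                 ≤⟨ ∑-mono-≤ (λ b → 6≤∑charge (λ a → S a b) x (nonemptyColumn b)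
                                                      (λ a → 3≤ (S a b) (degreeCondition-transpose S deg b a))) ⟩
    ∑[ b < m ] ∑[ a < n ] charge (S a b) (y b) (x a) ≡⟨ sym (∑-comm (λ a b → charge (S a b) (y b) (x a))) ⟩
    ∑∑ (λ a b → charge (S a b) (y b) (x a))      ≡⟨ cellwise (λ a b → proj₁ (proj₂ (cell a b))) ⟩
    ∑∑ (λ a b → 2 * α a b + 6 * β a b + 3 * γ a b)
                                                 ≡⟨ ∑∑-linear 2 6 3 α β γ ⟩
    2 * A + 6 * B + 3 * C                        ∎
    where open ≤-Reasoning
  size≡ : ∣ S ∣ᵥ ≡ A + B + C
  size≡ = begin
    ∣ S ∣ᵥ                                       ≡⟨ size≡∑∑ S ⟩
    ∑∑ (λ a b → 𝟙 (S a b))                       ≡⟨ cellwise (λ a b → proj₂ (proj₂ (cell a b))) ⟩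
    ∑∑ (λ a b → 1 * α a b + 1 * β a b + 1 * γ a b)
                                                 ≡⟨ ∑∑-linear 1 1 1 α β γ ⟩
    1 * A + 1 * B + 1 * C                        ≡⟨ cong₂ _+_ (cong₂ _+_ (*-identityˡ A) (*-identityˡ B)) (*-identityˡ C) ⟩
    A + B + C                                    ∎
    where open ≡-Reasoning

LowerBound : ℕ → ℕ → ℕ → Set
LowerBound n m k = (S : VSet n m) → IsDoubleTotalDom S → k ≤ ∣ S ∣ᵥ

2n≤size⊎chargeBound : {n m : ℕ} → n ≤ m → (S : VSet n m) → IsDoubleTotalDom S →
  2 * n ≤ ∣ S ∣ᵥ ⊎ ChargeBound n m ∣ S ∣ᵥ
2n≤size⊎chargeBound {n} {m} n≤m S dom = by-degrees (Equivalence.to (doubleTotalDom⇔degreeCondition S) dom)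
  where
  by-degrees : DegreeCondition S → 2 * n ≤ ∣ S ∣ᵥ ⊎ ChargeBound n m ∣ S ∣ᵥ
  by-degrees deg with any? (λ a → rowCount S a ≟ℕ 0) | any? (λ b → columnCount S b ≟ℕ 0)
  ... | yes (a , empty) | _ = inj₁ (≤-trans (*-monoʳ-≤ 2 n≤m) (emptyRow⇒2m≤size S deg a empty))
  ... | no _ | yes (b , empty) = inj₁ (emptyColumn⇒2n≤size S deg b empty)
  ... | no noEmptyRow | no noEmptyColumn = inj₂ (discharging S deg
    (λ a → n≢0⇒n>0 (λ empty → noEmptyRow (a , empty)))
    (λ b → n≢0⇒n>0 (λ empty → noEmptyColumn (b , empty))))

≡-mod⇒offset : ∀ a b d .{{_ : NonZero d}} → a % d ≡ b % d → a + (b / d) * d ≡ b + (a / d) * d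
≡-mod⇒offset a b d a≡b = begin
  a + (b / d) * d                    ≡⟨ cong (_+ (b / d) * d) (m≡m%n+[m/n]*n a d) ⟩
  a % d + (a / d) * d + (b / d) * d  ≡⟨ cong (λ r → r + (a / d) * d + (b / d) * d) a≡b ⟩
  b % d + (a / d) * d + (b / d) * d  ≡⟨ xy∙z≈xz∙y (b % d) ((a / d) * d) ((b / d) * d) ⟩
  b % d + (b / d) * d + (a / d) * d  ≡⟨ cong (_+ (a / d) * d) (sym (m≡m%n+[m/n]*n b d)) ⟩
  b + (a / d) * d                    ∎
  where open ≡-Reasoning

congruence⇒4∣n+m : ∀ n m → m % 8 ≡ (3 * n + 4) % 8 → 4 ∣ n + m
congruence⇒4∣n+m n m m≡ = from-offset n m ((3 * n + 4) / 8) (m / 8) (≡-mod⇒offset m (3 * n + 4) 8 m≡)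
  where
  from-offset : ∀ n m u v → m + u * 8 ≡ 3 * n + 4 + v * 8 → 4 ∣ n + m
  from-offset n m u v offset = ∣m+n∣m⇒∣n (divides (n + 1 + 2 * v) (begin
      u * 8 + (n + m)         ≡⟨ solve (u ∷ n ∷ m ∷ []) ⟩
      n + (m + u * 8)         ≡⟨ cong (n +_) offset ⟩
      n + (3 * n + 4 + v * 8) ≡⟨ solve (n ∷ v ∷ []) ⟩
      (n + 1 + 2 * v) * 4     ∎))
    (divides (2 * u) (solve (u ∷ [])))
    where open ≡-Reasoning

congruence⇒8A+3m≢9n : ∀ n m A → m % 8 ≡ (3 * n + 4) % 8 → 8 * A + 3 * m ≢ 9 * n
congruence⇒8A+3m≢9n n m A m≡ = from-offset n m A ((3 * n + 4) / 8) (m / 8) (≡-mod⇒offset m (3 * n + 4) 8 m≡)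
  where
  from-offset : ∀ n m A u v → m + u * 8 ≡ 3 * n + 4 + v * 8 → 8 * A + 3 * m ≢ 9 * n
  from-offset n m A u v offset 8A+3m≡9n = 0≢4 (begin
    0                                 ≡⟨ sym (m*n%n≡0 (3 * u) 8) ⟩
    (3 * u) * 8 % 8                   ≡⟨ cong (_% 8) (+-cancelˡ-≡ (3 * m) _ _ 3m+) ⟩
    (4 + (A + 1 + 3 * v) * 8) % 8     ≡⟨ [m+kn]%n≡m%n 4 (A + 1 + 3 * v) 8 ⟩
    4                                 ∎)
    where
    open ≡-Reasoning
    0≢4 : 0 ≢ 4
    0≢4 ()
    3m+ : 3 * m + (3 * u) * 8 ≡ 3 * m + (4 + (A + 1 + 3 * v) * 8)
    3m+ = begin
      3 * m + (3 * u) * 8               ≡⟨ solve (m ∷ u ∷ []) ⟩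
      3 * (m + u * 8)                   ≡⟨ cong (3 *_) offset ⟩
      3 * (3 * n + 4 + v * 8)           ≡⟨ solve (n ∷ v ∷ []) ⟩
      9 * n + 12 + 24 * v               ≡⟨ cong (λ k → k + 12 + 24 * v) (sym 8A+3m≡9n) ⟩
      8 * A + 3 * m + 12 + 24 * v       ≡⟨ solve (A ∷ m ∷ v ∷ []) ⟩
      3 * m + (4 + (A + 1 + 3 * v) * 8) ∎

x≤4k⇒⌈x/4⌉≤k : ∀ x k → x ≤ 4 * k → (x + 3) / 4 ≤ k
x≤4k⇒⌈x/4⌉≤k x k x≤4k = s≤s⁻¹ (m<n*o⇒m/o<n (begin-strict
  x + 3       <⟨ +-monoʳ-< x (n<1+n 3) ⟩
  x + 4       ≤⟨ +-monoˡ-≤ 4 x≤4k ⟩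
  4 * k + 4   ≡⟨ solve (k ∷ []) ⟩
  suc k * 4   ∎))
  where open ≤-Reasoning

4∣x⇒x<4k⇒⌈x/4⌉<k : ∀ x k → 4 ∣ x → x < 4 * k → (x + 3) / 4 < k
4∣x⇒x<4k⇒⌈x/4⌉<k .(q * 4) k (divides-refl q) q*4<4k = m<n*o⇒m/o<n (begin-strict
  q * 4 + 3   <⟨ +-monoʳ-< (q * 4) (n<1+n 3) ⟩
  q * 4 + 4   ≡⟨ +-comm (q * 4) 4 ⟩
  suc q * 4   ≤⟨ *-monoˡ-≤ 4 (*-cancelʳ-< _ q k (subst (q * 4 <_) (*-comm 4 k) q*4<4k)) ⟩
  k * 4       ∎)
  where open ≤-Reasoning

⌈3[n+m]/4⌉<2n : ∀ n m → 3 * m + 4 ≤ 5 * n → (3 * (n + m) + 3) / 4 < 2 * n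
⌈3[n+m]/4⌉<2n n m 3m+4≤5n = m<n*o⇒m/o<n (begin-strict
  3 * (n + m) + 3     <⟨ +-monoʳ-< _ (n<1+n 3) ⟩
  3 * (n + m) + 4     ≡⟨ solve (n ∷ m ∷ []) ⟩
  3 * n + (3 * m + 4) ≤⟨ +-monoʳ-≤ (3 * n) 3m+4≤5n ⟩
  3 * n + 5 * n       ≡⟨ solve (n ∷ []) ⟩
  2 * n * 4           ∎)
  where open ≤-Reasoning

lowerBound-single : ∀ m → LowerBound 1 (suc m) 3
lowerBound-single m S dom = singleRow⇒3≤size S (Equivalence.to (doubleTotalDom⇔degreeCondition S) dom)

lowerBound-2n : ∀ {n m} → n ≤ m → 5 * n ≤ 3 * m + 3 → LowerBound n m (2 * n)
lowerBound-2n {n} {m} n≤m 5n≤3m+3 S dom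
  with 2n≤size⊎chargeBound n≤m S dom
... | inj₁ 2n≤k = 2n≤k
... | inj₂ (3[n+m]≤4k , _) = m<1+n⇒m≤n (*-cancelˡ-< 4 _ _ (begin-strict
  4 * (2 * n)           ≡⟨ solve (n ∷ []) ⟩
  3 * n + 5 * n         ≤⟨ +-monoʳ-≤ (3 * n) 5n≤3m+3 ⟩
  3 * n + (3 * m + 3)   ≡⟨ solve (n ∷ m ∷ []) ⟩
  3 * (n + m) + 3       <⟨ +-monoʳ-< _ (n<1+n 3) ⟩
  3 * (n + m) + 4       ≤⟨ +-monoˡ-≤ 4 3[n+m]≤4k ⟩
  4 * ∣ S ∣ᵥ + 4        ≡⟨ trans (+-comm _ 4) (sym (*-suc 4 _)) ⟩
  4 * suc ∣ S ∣ᵥ        ∎))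
  where open ≤-Reasoning

lowerBound-⌈3[n+m]/4⌉ : ∀ {n m} → n ≤ m → 3 * m + 4 ≤ 5 * n → LowerBound n m ((3 * (n + m) + 3) / 4)
lowerBound-⌈3[n+m]/4⌉ {n} {m} n≤m 3m+4≤5n S dom
  with 2n≤size⊎chargeBound n≤m S dom
... | inj₁ 2n≤k = ≤-trans (<⇒≤ (⌈3[n+m]/4⌉<2n n m 3m+4≤5n)) 2n≤k
... | inj₂ (3[n+m]≤4k , _) = x≤4k⇒⌈x/4⌉≤k _ _ 3[n+m]≤4k

lowerBound-⌈3[n+m]/4⌉+1 : ∀ {n m} → n ≤ m → 3 * m + 4 ≤ 5 * n → m % 8 ≡ (3 * n + 4) % 8 →
  LowerBound n m ((3 * (n + m) + 3) / 4 + 1)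
lowerBound-⌈3[n+m]/4⌉+1 {n} {m} n≤m 3m+4≤5n m≡ S dom
  with 2n≤size⊎chargeBound n≤m S dom
... | inj₁ 2n≤k = subst (_≤ ∣ S ∣ᵥ) (+-comm 1 _) (≤-trans (⌈3[n+m]/4⌉<2n n m 3m+4≤5n) 2n≤k)
... | inj₂ (3[n+m]≤4k , tight) = subst (_≤ ∣ S ∣ᵥ) (+-comm 1 _)
  (4∣x⇒x<4k⇒⌈x/4⌉<k _ _ (∣n⇒∣m*n 3 (congruence⇒4∣n+m n m m≡)) (≤∧≢⇒< 3[n+m]≤4k not-tight))
  where
  not-tight : 3 * (n + m) ≢ 4 * ∣ S ∣ᵥ
  not-tight eq with (A , 8A+3m≡9n) ← tight (sym eq) = congruence⇒8A+3m≢9n n m A m≡ 8A+3m≡9n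

-- Constructions
UpperBound : ℕ → ℕ → ℕ → Set
UpperBound n m k = Σ[ S ∈ VSet n m ] IsDoubleTotalDom S × ∣ S ∣ᵥ ≤ k

upperBound-mono : ∀ {n m k k′} → k ≤ k′ → UpperBound n m k → UpperBound n m k′
upperBound-mono k≤k′ (S , dom , size≤k) = S , dom , ≤-trans size≤k k≤k′

upperBound-intro : ∀ {n m k} (S : VSet n m) → DegreeCondition S → ∣ S ∣ᵥ ≤ k → UpperBound n m k
upperBound-intro S deg size≤k = S , Equivalence.from (doubleTotalDom⇔degreeCondition S) deg , size≤k

gamma-intro : ∀ {n m k} → UpperBound n m k → LowerBound n m k → Gamma×2t n m k
gamma-intro (S , dom , size≤k) lower = (S , dom , ≤-antisym size≤k (lower S dom)) , lower

countBelow : ℕ → (ℕ → Bool) → ℕ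
countBelow m P = countF {m} (P ∘ toℕ)

countBelow-mono : ∀ m {P Q : ℕ → Bool} → (∀ i → P i ≡ true → Q i ≡ true) → countBelow m P ≤ countBelow m Q
countBelow-mono zero    P⇒Q = z≤n
countBelow-mono (suc m) {P} {Q} P⇒Q with P 0 in P0 | Q 0 in Q0
... | true  | true  = s≤s (countBelow-mono m (P⇒Q ∘ suc))
... | true  | false = contradiction (trans (sym (P⇒Q 0 P0)) Q0) λ ()
... | false | q     = ≤-trans (countBelow-mono m (P⇒Q ∘ suc)) (m≤n+m _ (𝟙 q))

countBelow-∨ : ∀ m (P Q : ℕ → Bool) → countBelow m (λ i → P i ∨ Q i) ≤ countBelow m P + countBelow m Q
countBelow-∨ zero    P Q = z≤n
countBelow-∨ (suc m) P Q with P 0 | Q 0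
... | true  | true  = s≤s (≤-trans (countBelow-∨ m (P ∘ suc) (Q ∘ suc)) (≤-trans (m≤n+m _ 1) (≤-reflexive (sym (+-suc _ _)))))
... | true  | false = s≤s (countBelow-∨ m (P ∘ suc) (Q ∘ suc))
... | false | true  = ≤-trans (s≤s (countBelow-∨ m (P ∘ suc) (Q ∘ suc))) (≤-reflexive (sym (+-suc _ _)))
... | false | false = countBelow-∨ m (P ∘ suc) (Q ∘ suc)

countBelow-false : ∀ m → countBelow m (λ _ → false) ≡ 0
countBelow-false zero    = refl
countBelow-false (suc m) = countBelow-false m

countBelow-∧≡ᵇ : ∀ m c t → countBelow m (λ i → c ∧ (i ≡ᵇ t)) ≤ 𝟙 c
countBelow-∧≡ᵇ m       false t       = ≤-reflexive (countBelow-false m)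
countBelow-∧≡ᵇ zero    true  t       = z≤n
countBelow-∧≡ᵇ (suc m) true  zero    = s≤s (≤-reflexive (countBelow-false m))
countBelow-∧≡ᵇ (suc m) true  (suc t) = countBelow-∧≡ᵇ m true t

countBelow-true : ∀ m → countBelow m (λ _ → true) ≡ m
countBelow-true zero    = refl
countBelow-true (suc m) = cong suc (countBelow-true m)

countBelow-≥ : ∀ m p → countBelow m (λ i → not (i <ᵇ p)) ≡ m ∸ p
countBelow-≥ m       zero    = countBelow-true m
countBelow-≥ zero    (suc p) = refl
countBelow-≥ (suc m) (suc p) = countBelow-≥ m p

countBelow-< : ∀ m len → len ≤ m → countBelow m (_<ᵇ len) ≡ len
countBelow-< m       zero      _           = countBelow-false m
countBelow-< (suc m) (suc len) (s≤s len≤m) = cong suc (countBelow-< m len len≤m)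

countBelow-interval : ∀ m lo len → lo + len ≤ m → countBelow m (λ i → not (i <ᵇ lo) ∧ (i <ᵇ lo + len)) ≡ len
countBelow-interval m       zero     len bound       = countBelow-< m len bound
countBelow-interval (suc m) (suc lo) len (s≤s bound) = countBelow-interval m lo len bound

countBelow-witness : ∀ m (P : ℕ → Bool) i → i < m → P i ≡ true → 1 ≤ countBelow m P
countBelow-witness (suc m) P zero    _         P0 = subst (λ b → 1 ≤ 𝟙 b + countBelow m (P ∘ suc)) (sym P0) (s≤s z≤n)
countBelow-witness (suc m) P (suc i) (s≤s i<m) Pi =
  ≤-trans (countBelow-witness m (P ∘ suc) i i<m Pi) (m≤n+m _ (𝟙 (P 0)))

<ᵇ≡true : ∀ {i j} → i < j → (i <ᵇ j) ≡ true
<ᵇ≡true i<j = Equivalence.to T-≡ (<⇒<ᵇ i<j)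

<ᵇ≡false : ∀ {i j} → j ≤ i → (i <ᵇ j) ≡ false
<ᵇ≡false {i} {j} j≤i with i <ᵇ j in e
... | false = refl
... | true  = contradiction (<ᵇ⇒< i j (Equivalence.from T-≡ e)) (≤⇒≯ j≤i)

≡ᵇ-refl : ∀ i → (i ≡ᵇ i) ≡ true
≡ᵇ-refl i = Equivalence.to T-≡ (≡⇒≡ᵇ i i refl)

∈-interval : ∀ {i lo hi} → (not (i <ᵇ lo) ∧ (i <ᵇ hi)) ≡ true → lo ≤ i × i < hi
∈-interval {i} {lo} {hi} h with i <ᵇ lo in e₁ | i <ᵇ hi in e₂
... | false | true = ≮⇒≥ (λ i<lo → contradiction (trans (sym (<ᵇ≡true i<lo)) e₁) λ ())
                   , <ᵇ⇒< i hi (Equivalence.from T-≡ e₂)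

degree-of-cell : ∀ x y {r c} → (x ≡ true → 3 ≤ c) → (y ≡ true → 3 ≤ r) → 1 ≤ r → 1 ≤ c →
  2 + 2 * 𝟙 (x ∨ y) ≤ r + c
degree-of-cell true  _     heavyColumn _        1≤r _   = +-mono-≤ 1≤r (heavyColumn refl)
degree-of-cell false true  _           heavyRow _   1≤c = +-mono-≤ (heavyRow refl) 1≤c
degree-of-cell false false _           _        1≤r 1≤c = +-mono-≤ 1≤r 1≤c

firstColumns : ∀ {n m} → ℕ → VSet n m
firstColumns w a b = toℕ b <ᵇ w

firstColumns-upperBound : ∀ {n m} w → 2 ≤ w → w ≤ m → 4 ≤ w + n → UpperBound n m (n * w)
firstColumns-upperBound {n} {m} w 2≤w w≤m 4≤w+n = upperBound-intro (firstColumns {n} {m} w) degrees (≤-reflexive size)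
  where
  rows : ∀ a → rowCount (firstColumns {n} {m} w) a ≡ w
  rows a = countBelow-< m w w≤m
  degrees : DegreeCondition (firstColumns {n} {m} w)
  degrees a b = subst (λ r → 2 + 2 * 𝟙 (toℕ b <ᵇ w) ≤ r + columnCount (firstColumns {n} {m} w) b) (sym (rows a)) (column b)
    where
    column : ∀ b → 2 + 2 * 𝟙 (toℕ b <ᵇ w) ≤ w + countF {n} (λ _ → toℕ b <ᵇ w)
    column b with toℕ b <ᵇ w
    ... | true  = subst (λ c → 4 ≤ w + c) (sym (countBelow-true n)) 4≤w+n
    ... | false = subst (λ c → 2 ≤ w + c) (sym (countBelow-false n)) (≤-trans 2≤w (m≤m+n w 0))
  size : ∣ firstColumns {n} {m} w ∣ᵥ ≡ n * w
  size = trans (size≡∑rowCount (firstColumns {n} {m} w)) (trans (sum-cong-≗ rows) (∑-const n w))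

/3-block : ∀ h i → 3 * h ≤ i → i < 3 * h + 3 → i / 3 ≡ h
/3-block h i lo hi = begin
  i / 3                       ≡⟨ cong (_/ 3) (sym (trans (cong (i ∸ 3 * h +_) (*-comm h 3)) (m∸n+n≡m lo))) ⟩
  (i ∸ 3 * h + h * 3) / 3     ≡⟨ +-distrib-/-∣ʳ (i ∸ 3 * h) (divides-refl h) ⟩
  (i ∸ 3 * h) / 3 + h * 3 / 3 ≡⟨ cong₂ _+_ (m<n⇒m/n≡0 (m<n+o⇒m∸n<o i (3 * h) hi)) (m*n/n≡m h 3) ⟩
  h                           ∎
  where open ≡-Reasoning

-- The spider with hub rows i < p and hub columns j < q: each other row i holds one vertex, in hub column
-- hub q (i − p), the outer rows going in threes to the hubs (the last hub taking any surplus), and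
-- symmetrically for the other columns. Hub lines carry at least 3 vertices, every line at least 1, every
-- vertex lies on a hub line, and there are (n − p) + (m − q) vertices.
hub : ℕ → ℕ → ℕ
hub c i = i / 3 ⊓ (c ∸ 1)

hub< : ∀ {c} i → 1 ≤ c → hub c i < c
hub< {suc c} i _ = s≤s (m⊓n≤n (i / 3) c)

hub-block : ∀ {c} h i → h < c → 3 * h ≤ i → i < 3 * h + 3 → hub c i ≡ h
hub-block {suc c} h i (s≤s h≤c) lo hi = trans (cong (_⊓ c) (/3-block h i lo hi)) (m≤n⇒m⊓n≡m h≤c)

attached : ℕ → ℕ → ℕ → ℕ → Bool
attached p q i j = not (i <ᵇ p) ∧ (j ≡ᵇ hub q (i ∸ p))

attached⇒< : ∀ {p q i j} → 1 ≤ q → attached p q i j ≡ true → j < q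
attached⇒< {p} {q} {i} {j} 1≤q e with i <ᵇ p
... | false = subst (_< q) (sym (≡ᵇ⇒≡ j _ (Equivalence.from T-≡ e))) (hub< (i ∸ p) 1≤q)

spiderLine : ℕ → ℕ → ℕ → ℕ → Bool
spiderLine p q i j = attached p q i j ∨ attached q p j i

spider : ∀ {n m} → ℕ → ℕ → VSet n m
spider p q a b = spiderLine p q (toℕ a) (toℕ b)

hubLine-≥3 : ∀ {p q m} i → i < p → q + 3 * p ≤ m → 3 ≤ countBelow m (spiderLine p q i)
hubLine-≥3 {p} {q} {m} i i<p bound = begin
  3                                                                  ≡⟨ sym (countBelow-interval m (q + 3 * i) 3 fits) ⟩
  countBelow m (λ j → not (j <ᵇ q + 3 * i) ∧ (j <ᵇ q + 3 * i + 3))   ≤⟨ countBelow-mono m inside ⟩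
  countBelow m (spiderLine p q i)                                    ∎
  where
  open ≤-Reasoning
  fits : q + 3 * i + 3 ≤ m
  fits = begin
    q + 3 * i + 3  ≡⟨ solve (q ∷ i ∷ []) ⟩
    q + 3 * suc i  ≤⟨ +-monoʳ-≤ q (*-monoʳ-≤ 3 i<p) ⟩
    q + 3 * p      ≤⟨ bound ⟩
    m              ∎
  inside : ∀ j → (not (j <ᵇ q + 3 * i) ∧ (j <ᵇ q + 3 * i + 3)) ≡ true → spiderLine p q i j ≡ true
  inside j h = trans (cong (attached p q i j ∨_) attached-to-hub) (∨-zeroʳ _)
    where
    lo : q + 3 * i ≤ j
    lo = proj₁ (∈-interval {j} {q + 3 * i} {q + 3 * i + 3} h)
    hi : j < q + 3 * i + 3
    hi = proj₂ (∈-interval {j} {q + 3 * i} {q + 3 * i + 3} h)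
    q≤j : q ≤ j
    q≤j = ≤-trans (m≤m+n q (3 * i)) lo
    attached-to-hub : attached q p j i ≡ true
    attached-to-hub = trans
      (cong₂ (λ u h → not u ∧ (i ≡ᵇ h)) (<ᵇ≡false q≤j)
        (hub-block i (j ∸ q) i<p
          (subst (_≤ j ∸ q) (m+n∸m≡n q (3 * i)) (∸-monoˡ-≤ q lo))
          (subst (j ∸ q <_) (m+n∸m≡n q (3 * i + 3))
            (∸-monoˡ-< (subst (j <_) (+-assoc q (3 * i) 3) hi) q≤j))))
      (≡ᵇ-refl i)

line-≥1 : ∀ {p q m} i → 1 ≤ q → q + 3 * p ≤ m → 1 ≤ countBelow m (spiderLine p q i)
line-≥1 {p} {q} {m} i 1≤q bound with i <? p
... | yes i<p = ≤-trans (s≤s z≤n) (hubLine-≥3 {p} {q} i i<p bound)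
... | no  i≮p = countBelow-witness m (spiderLine p q i) j j<m (cong (_∨ attached q p j i) attached-to-j)
  where
  j : ℕ
  j = hub q (i ∸ p)
  j<m : j < m
  j<m = ≤-trans (hub< {q} (i ∸ p) 1≤q) (≤-trans (m≤m+n q (3 * p)) bound)
  attached-to-j : attached p q i j ≡ true
  attached-to-j = trans (cong (λ u → not u ∧ (j ≡ᵇ j)) (<ᵇ≡false (≮⇒≥ i≮p))) (≡ᵇ-refl j)

spider-degrees : ∀ {n m} p q → 1 ≤ p → 1 ≤ q → p + 3 * q ≤ n → q + 3 * p ≤ m → DegreeCondition (spider {n} {m} p q)
spider-degrees {n} {m} p q 1≤p 1≤q fits-n fits-m a b =
  degree-of-cell (attached p q i j) (attached q p j i)
    (λ e → ≤-trans (hubLine-≥3 {q} {p} j (attached⇒< {p} {q} {i} {j} 1≤q e) fits-n) column≥)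
    (λ e → hubLine-≥3 {p} {q} i (attached⇒< {q} {p} {j} {i} 1≤p e) fits-m)
    (line-≥1 {p} {q} i 1≤q fits-m)
    (≤-trans (line-≥1 {q} {p} j 1≤p fits-n) column≥)
  where
  i j : ℕ
  i = toℕ a
  j = toℕ b
  column≥ : countBelow n (spiderLine q p j) ≤ columnCount (spider {n} {m} p q) b
  column≥ = countBelow-mono n (λ i′ e → trans (∨-comm (attached p q i′ j) (attached q p j i′)) e)

∑attached≤ : ∀ n m p q → ∑[ a < n ] countBelow m (attached p q (toℕ a)) ≤ n ∸ p
∑attached≤ n m p q = begin
  ∑[ a < n ] countBelow m (attached p q (toℕ a))  ≤⟨ ∑-mono-≤ {n} (λ a → countBelow-∧≡ᵇ m (not (toℕ a <ᵇ p)) (hub q (toℕ a ∸ p))) ⟩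
  ∑[ a < n ] 𝟙 (not (toℕ a <ᵇ p))                ≡⟨ sym (count≡∑ {n} (λ a → not (toℕ a <ᵇ p))) ⟩
  countBelow n (λ i → not (i <ᵇ p))               ≡⟨ countBelow-≥ n p ⟩
  n ∸ p                                           ∎
  where open ≤-Reasoning

spider-size : ∀ {n m} p q → ∣ spider {n} {m} p q ∣ᵥ ≤ (n ∸ p) + (m ∸ q)
spider-size {n} {m} p q = begin
  ∣ spider {n} {m} p q ∣ᵥ                                         ≡⟨ size≡∑rowCount (spider {n} {m} p q) ⟩
  ∑[ a < n ] countBelow m (spiderLine p q (toℕ a))                ≤⟨ ∑-mono-≤ {n} (λ a → countBelow-∨ m (attached p q (toℕ a)) (λ j → attached q p j (toℕ a))) ⟩
  ∑[ a < n ] (countBelow m (attached p q (toℕ a)) + rowCount H a) ≡⟨ ∑-distrib-+ {n} (λ a → countBelow m (attached p q (toℕ a))) (rowCount H) ⟩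
  ∑[ a < n ] countBelow m (attached p q (toℕ a)) + ∑[ a < n ] rowCount H a
    ≡⟨ cong (∑[ a < n ] countBelow m (attached p q (toℕ a)) +_) (trans (sym (size≡∑rowCount H)) (size≡∑columnCount H)) ⟩
  ∑[ a < n ] countBelow m (attached p q (toℕ a)) + ∑[ b < m ] countBelow n (attached q p (toℕ b))
    ≤⟨ +-mono-≤ (∑attached≤ n m p q) (∑attached≤ m n q p) ⟩
  (n ∸ p) + (m ∸ q)                                               ∎
  where
  open ≤-Reasoning
  H : VSet n m
  H a b = attached q p (toℕ b) (toℕ a)

spider-upperBound : ∀ {n m} p q → 1 ≤ p → 1 ≤ q → p + 3 * q ≤ n → q + 3 * p ≤ m → UpperBound n m (n + m ∸ (p + q))
spider-upperBound {n} {m} p q 1≤p 1≤q fits-n fits-m =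
  upperBound-intro (spider p q) (spider-degrees p q 1≤p 1≤q fits-n fits-m) (≤-trans (spider-size p q) (≤-reflexive size≡))
  where
  p≤n : p ≤ n
  p≤n = ≤-trans (m≤m+n p (3 * q)) fits-n
  q≤m : q ≤ m
  q≤m = ≤-trans (m≤m+n q (3 * p)) fits-m
  size≡ : (n ∸ p) + (m ∸ q) ≡ n + m ∸ (p + q)
  size≡ = begin
    (n ∸ p) + (m ∸ q)                       ≡⟨ sym (m+n∸n≡m _ (p + q)) ⟩
    (n ∸ p) + (m ∸ q) + (p + q) ∸ (p + q)   ≡⟨ cong (_∸ (p + q)) (+-interchange (n ∸ p) (m ∸ q) p q) ⟩
    ((n ∸ p) + p) + ((m ∸ q) + q) ∸ (p + q) ≡⟨ cong₂ (λ x y → x + y ∸ (p + q)) (m∸n+n≡m p≤n) (m∸n+n≡m q≤m) ⟩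
    n + m ∸ (p + q)                         ∎
    where open ≡-Reasoning

-- Choosing the spider for n ≥ 11
⌈3s/4⌉+⌊s/4⌋≡s : ∀ s → (3 * s + 3) / 4 + s / 4 ≡ s
⌈3s/4⌉+⌊s/4⌋≡s s = trans (cong (λ x → (3 * x + 3) / 4 + s / 4) s≡) (trans (split (s % 4) (s / 4) (m%n<n s 4)) (sym s≡))
  where
  s≡ : s ≡ s % 4 + s / 4 * 4
  s≡ = m≡m%n+[m/n]*n s 4
  small : ∀ r → r < 4 → (3 * r + 3) / 4 ≡ r
  small 0 _ = refl
  small 1 _ = refl
  small 2 _ = refl
  small 3 _ = refl
  small (suc (suc (suc (suc r)))) (s≤s (s≤s (s≤s (s≤s ()))))
  split : ∀ r c → r < 4 → (3 * (r + c * 4) + 3) / 4 + c ≡ r + c * 4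
  split r c r<4 = begin
    (3 * (r + c * 4) + 3) / 4 + c      ≡⟨ cong (λ x → x / 4 + c) (3 * (r + c * 4) + 3 ≡ 3 * r + 3 + 3 * c * 4 ∋ solve (r ∷ c ∷ [])) ⟩
    (3 * r + 3 + 3 * c * 4) / 4 + c    ≡⟨ cong (_+ c) (+-distrib-/-∣ʳ (3 * r + 3) (divides-refl (3 * c))) ⟩
    (3 * r + 3) / 4 + 3 * c * 4 / 4 + c ≡⟨ cong₂ (λ x y → x + y + c) (small r r<4) (m*n/n≡m (3 * c) 4) ⟩
    r + 3 * c + c                      ≡⟨ solve (r ∷ c ∷ []) ⟩
    r + c * 4                          ∎
    where open ≡-Reasoning

split-fits : ∀ n m e p q t → p + q ≡ e → n ≡ e + (t + q * 2) → 4 * e + t ≤ n + m → p + 3 * q ≤ n × q + 3 * p ≤ m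
split-fits n m e p q t p+q≡e n≡ 4*e+t≤n+m = fits-n , fits-m
  where
  open ≤-Reasoning
  fits-n : p + 3 * q ≤ n
  fits-n = begin
    p + 3 * q           ≡⟨ solve (p ∷ q ∷ []) ⟩
    p + q + q * 2       ≡⟨ cong (_+ q * 2) p+q≡e ⟩
    e + q * 2           ≤⟨ +-monoʳ-≤ e (m≤n+m (q * 2) t) ⟩
    e + (t + q * 2)     ≡⟨ sym n≡ ⟩
    n                   ∎
  fits-m : q + 3 * p ≤ m
  fits-m = +-cancelʳ-≤ n (q + 3 * p) m (begin
    q + 3 * p + n                   ≡⟨ cong (q + 3 * p +_) n≡ ⟩
    q + 3 * p + (e + (t + q * 2))   ≡⟨ solve (p ∷ q ∷ e ∷ t ∷ []) ⟩
    3 * (p + q) + e + t             ≡⟨ cong (λ x → 3 * x + e + t) p+q≡e ⟩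
    3 * e + e + t                   ≡⟨ solve (e ∷ t ∷ []) ⟩
    4 * e + t                       ≤⟨ 4*e+t≤n+m ⟩
    n + m                           ≡⟨ +-comm n m ⟩
    m + n                           ∎)

split-e+2≤n : ∀ n m e → 5 ≤ n → 3 * m + 4 ≤ 5 * n → 4 * e ≤ n + m → e + 2 ≤ n
split-e+2≤n n m e 5≤n 3m+4≤5n 4*e≤n+m = *-cancelˡ-≤ 12 (begin
  12 * (e + 2)             ≡⟨ solve (e ∷ []) ⟩
  3 * (4 * e) + 24         ≤⟨ +-monoˡ-≤ 24 (*-monoʳ-≤ 3 4*e≤n+m) ⟩
  3 * (n + m) + 24         ≡⟨ solve (n ∷ m ∷ []) ⟩
  3 * n + (3 * m + 4) + 20 ≤⟨ +-monoˡ-≤ 20 (+-monoʳ-≤ (3 * n) 3m+4≤5n) ⟩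
  3 * n + 5 * n + 20       ≤⟨ +-monoʳ-≤ (3 * n + 5 * n) (*-monoʳ-≤ 4 5≤n) ⟩
  3 * n + 5 * n + 4 * n    ≡⟨ solve (n ∷ []) ⟩
  12 * n                   ∎)
  where open ≤-Reasoning

split-q<e : ∀ n m e q t → 11 ≤ n → n ≤ m → n ≡ e + (t + q * 2) → n + m ≤ 4 * e + 7 → q < e
split-q<e n m e q t 11≤n n≤m n≡ n+m≤ = ≰⇒> e≰q
  where
  open ≤-Reasoning
  e≰q : ¬ e ≤ q
  e≰q e≤q = 1+n≰n 22≤21
    where
    2n≤ : 2 * n ≤ 4 * e + 7
    2n≤ = begin
      2 * n             ≡⟨ solve (n ∷ []) ⟩
      n + n             ≤⟨ +-monoʳ-≤ n n≤m ⟩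
      n + m             ≤⟨ n+m≤ ⟩
      4 * e + 7         ∎
    3*e≤n : 3 * e ≤ n
    3*e≤n = begin
      3 * e             ≡⟨ solve (e ∷ []) ⟩
      e + e * 2         ≤⟨ +-monoʳ-≤ e (≤-trans (*-monoˡ-≤ 2 e≤q) (m≤n+m (q * 2) t)) ⟩
      e + (t + q * 2)   ≡⟨ sym n≡ ⟩
      n                 ∎
    2*e≤7 : 2 * e ≤ 7
    2*e≤7 = +-cancelʳ-≤ (4 * e) (2 * e) 7 (begin
      2 * e + 4 * e     ≡⟨ solve (e ∷ []) ⟩
      2 * (3 * e)       ≤⟨ *-monoʳ-≤ 2 3*e≤n ⟩
      2 * n             ≤⟨ 2n≤ ⟩
      4 * e + 7         ≡⟨ +-comm (4 * e) 7 ⟩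
      7 + 4 * e         ∎)
    22≤21 : 22 ≤ 21
    22≤21 = begin
      22                ≤⟨ *-monoʳ-≤ 2 11≤n ⟩
      2 * n             ≤⟨ 2n≤ ⟩
      4 * e + 7         ≡⟨ solve (e ∷ []) ⟩
      2 * (2 * e) + 7   ≤⟨ +-monoˡ-≤ 7 (*-monoʳ-≤ 2 2*e≤7) ⟩
      21                ∎

split-1≤q : ∀ t q → t < 2 → 2 ≤ t + q * 2 → 1 ≤ q
split-1≤q t zero    t<2 2≤t = contradiction (subst (2 ≤_) (+-identityʳ t) 2≤t) (<⇒≱ t<2)
split-1≤q t (suc q) _   _   = s≤s z≤n

spider-of-split : ∀ n m e → 11 ≤ n → n ≤ m → 3 * m + 4 ≤ 5 * n →
  4 * e + (n ∸ e) % 2 ≤ n + m → n + m ≤ 4 * e + 7 → UpperBound n m (n + m ∸ e)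
spider-of-split n m e 11≤n n≤m 3m+4≤5n lower upper =
  subst (λ k → UpperBound n m (n + m ∸ k)) p+q≡e (spider-upperBound p q 1≤p 1≤q (proj₁ fits) (proj₂ fits))
  where
  t q p : ℕ
  t = (n ∸ e) % 2
  q = (n ∸ e) / 2
  p = e ∸ q
  e+2≤n : e + 2 ≤ n
  e+2≤n = split-e+2≤n n m e (≤-trans (m≤m+n 5 6) 11≤n) 3m+4≤5n (≤-trans (m≤m+n (4 * e) t) lower)
  n≡ : n ≡ e + (t + q * 2)
  n≡ = trans (sym (m+[n∸m]≡n (≤-trans (m≤m+n e 2) e+2≤n))) (cong (e +_) (m≡m%n+[m/n]*n (n ∸ e) 2))
  1≤q : 1 ≤ q
  1≤q = split-1≤q t q (m%n<n (n ∸ e) 2) (+-cancelˡ-≤ e 2 (t + q * 2) (subst (e + 2 ≤_) n≡ e+2≤n))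
  q<e : q < e
  q<e = split-q<e n m e q t 11≤n n≤m n≡ upper
  p+q≡e : p + q ≡ e
  p+q≡e = m∸n+n≡m (<⇒≤ q<e)
  1≤p : 1 ≤ p
  1≤p = m<n⇒0<n∸m q<e
  fits : p + 3 * q ≤ n × q + 3 * p ≤ m
  fits = split-fits n m e p q t p+q≡e n≡ lower

⌈3s/4⌉≡s∸⌊s/4⌋ : ∀ s → (3 * s + 3) / 4 ≡ s ∸ s / 4
⌈3s/4⌉≡s∸⌊s/4⌋ s = trans (sym (m+n∸n≡m _ (s / 4))) (cong (_∸ s / 4) (⌈3s/4⌉+⌊s/4⌋≡s s))

split-parity : ∀ n m e q → n + m ≡ e * 4 → n ≡ e + (1 + q * 2) → m % 8 ≡ (3 * n + 4) % 8
split-parity n m e q n+m≡ n≡ = sym (trans (cong (_% 8) 3n+4≡) ([m+kn]%n≡m%n m (q + 1) 8))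
  where
  3n+4≡ : 3 * n + 4 ≡ m + (q + 1) * 8
  3n+4≡ = +-cancelʳ-≡ n _ _ (begin
    3 * n + 4 + n                 ≡⟨ solve (n ∷ []) ⟩
    4 * n + 4                     ≡⟨ cong (λ x → 4 * x + 4) n≡ ⟩
    4 * (e + (1 + q * 2)) + 4     ≡⟨ solve (e ∷ q ∷ []) ⟩
    e * 4 + (q + 1) * 8           ≡⟨ cong (_+ (q + 1) * 8) (sym n+m≡) ⟩
    n + m + (q + 1) * 8           ≡⟨ solve (n ∷ m ∷ q ∷ []) ⟩
    m + (q + 1) * 8 + n           ∎)
    where open ≡-Reasoning

upperBound-large-⌈3[n+m]/4⌉ : ∀ n m → 11 ≤ n → n ≤ m → 3 * m + 4 ≤ 5 * n → ¬ (m % 8 ≡ (3 * n + 4) % 8) →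
  UpperBound n m ((3 * (n + m) + 3) / 4)
upperBound-large-⌈3[n+m]/4⌉ n m 11≤n n≤m 3m+4≤5n m≢ =
  subst (UpperBound n m) (sym (⌈3s/4⌉≡s∸⌊s/4⌋ (n + m))) (spider-of-split n m e 11≤n n≤m 3m+4≤5n lower upper)
  where
  open ≤-Reasoning
  e r t q : ℕ
  e = (n + m) / 4
  r = (n + m) % 4
  t = (n ∸ e) % 2
  q = (n ∸ e) / 2
  s≡ : n + m ≡ r + e * 4
  s≡ = m≡m%n+[m/n]*n (n + m) 4
  4e≤s : 4 * e ≤ n + m
  4e≤s = ≤-trans (≤-reflexive (*-comm 4 e)) (≤-trans (m≤n+m (e * 4) r) (≤-reflexive (sym s≡)))
  upper : n + m ≤ 4 * e + 7
  upper = begin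
    n + m       ≡⟨ s≡ ⟩
    r + e * 4   ≤⟨ +-monoˡ-≤ (e * 4) (≤-trans (s≤s⁻¹ (m%n<n (n + m) 4)) (m≤m+n 3 4)) ⟩
    7 + e * 4   ≡⟨ trans (+-comm 7 (e * 4)) (cong (_+ 7) (*-comm e 4)) ⟩
    4 * e + 7   ∎
  -- the split can only fail by parity, and that failure is exactly the excluded congruence
  lower : 4 * e + t ≤ n + m
  lower with t ≤? r
  ... | yes t≤r = begin
    4 * e + t   ≤⟨ +-monoʳ-≤ (4 * e) t≤r ⟩
    4 * e + r   ≡⟨ trans (+-comm (4 * e) r) (cong (r +_) (*-comm 4 e)) ⟩
    r + e * 4   ≡⟨ sym s≡ ⟩
    n + m       ∎
  ... | no  t≰r = contradiction (split-parity n m e q (trans s≡ (cong (_+ e * 4) r≡0)) n≡) m≢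
    where
    r<t : r < t
    r<t = ≰⇒> t≰r
    t≤1 : t ≤ 1
    t≤1 = s≤s⁻¹ (m%n<n (n ∸ e) 2)
    r≡0 : r ≡ 0
    r≡0 = n<1⇒n≡0 (≤-trans r<t t≤1)
    t≡1 : t ≡ 1
    t≡1 = ≤-antisym t≤1 (≤-trans (s≤s z≤n) r<t)
    e≤n : e ≤ n
    e≤n = ≤-trans (m≤m+n e 2) (split-e+2≤n n m e (≤-trans (m≤m+n 5 6) 11≤n) 3m+4≤5n 4e≤s)
    n≡ : n ≡ e + (1 + q * 2)
    n≡ = trans (sym (m+[n∸m]≡n e≤n)) (cong (e +_) (trans (m≡m%n+[m/n]*n (n ∸ e) 2) (cong (_+ q * 2) t≡1)))

upperBound-large-⌈3[n+m]/4⌉+1 : ∀ n m → 11 ≤ n → n ≤ m → 3 * m + 4 ≤ 5 * n →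
  UpperBound n m ((3 * (n + m) + 3) / 4 + 1)
upperBound-large-⌈3[n+m]/4⌉+1 n m 11≤n n≤m 3m+4≤5n =
  subst (UpperBound n m) target≡ (spider-of-split n m e 11≤n n≤m 3m+4≤5n lower upper)
  where
  open ≤-Reasoning
  c e r t ⌈3s/4⌉ : ℕ
  c = (n + m) / 4
  e = c ∸ 1
  r = (n + m) % 4
  t = (n ∸ e) % 2
  ⌈3s/4⌉ = (3 * (n + m) + 3) / 4
  s≡ : n + m ≡ r + c * 4
  s≡ = m≡m%n+[m/n]*n (n + m) 4
  c≡ : c ≡ suc e
  c≡ = sym (trans (+-comm 1 e) (m∸n+n≡m (m≥n⇒m/n>0 {n + m} {4}
         (≤-trans (s≤s (s≤s (s≤s (s≤s z≤n)))) (≤-trans 11≤n (m≤m+n n m))))))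
  target≡ : n + m ∸ e ≡ ⌈3s/4⌉ + 1
  target≡ = trans (cong (_∸ e) (trans (sym (⌈3s/4⌉+⌊s/4⌋≡s (n + m))) (cong (⌈3s/4⌉ +_) c≡)))
                  (trans (cong (_∸ e) (sym (+-assoc ⌈3s/4⌉ 1 e))) (m+n∸n≡m (⌈3s/4⌉ + 1) e))
  lower : 4 * e + t ≤ n + m
  lower = begin
    4 * e + t   ≤⟨ +-monoʳ-≤ (4 * e) (≤-trans (s≤s⁻¹ (m%n<n (n ∸ e) 2)) (m≤m+n 1 3)) ⟩
    4 * e + 4   ≡⟨ trans (+-comm (4 * e) 4) (trans (sym (*-suc 4 e)) (*-comm 4 (suc e))) ⟩
    suc e * 4   ≡⟨ cong (_* 4) (sym c≡) ⟩
    c * 4       ≤⟨ m≤n+m (c * 4) r ⟩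
    r + c * 4   ≡⟨ sym s≡ ⟩
    n + m       ∎
  upper : n + m ≤ 4 * e + 7
  upper = begin
    n + m       ≡⟨ s≡ ⟩
    r + c * 4   ≤⟨ +-monoˡ-≤ (c * 4) (s≤s⁻¹ (m%n<n (n + m) 4)) ⟩
    3 + c * 4   ≡⟨ cong (λ x → 3 + x * 4) c≡ ⟩
    7 + e * 4   ≡⟨ trans (+-comm 7 (e * 4)) (cong (_+ 7) (*-comm e 4)) ⟩
    4 * e + 7   ∎

-- Small cases, by computation
degreeCondition? : ∀ {n m} (S : VSet n m) → Dec (DegreeCondition S)
degreeCondition? S = all? λ a → all? λ b → 2 + 2 * 𝟙 (S a b) ≤? rowCount S a + columnCount S b

cross : VSet 3 3
cross zero    _       = true
cross (suc _) zero    = true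
cross (suc _) (suc _) = false

cross-upperBound : UpperBound 3 3 5
cross-upperBound = upperBound-intro cross (toWitness {a? = degreeCondition? cross} tt) ≤-refl

construction? : (n m k : ℕ) → Maybe (UpperBound n m k)
construction? n m k = spiders n <∣> (twoColumns <∣> crossing)
  where
  spider? : ℕ → ℕ → Maybe (UpperBound n m k)
  spider? p q with 1 ≤? p | 1 ≤? q | p + 3 * q ≤? n | q + 3 * p ≤? m | n + m ∸ (p + q) ≤? k
  ... | yes 1≤p | yes 1≤q | yes fits-n | yes fits-m | yes small =
    just (upperBound-mono small (spider-upperBound p q 1≤p 1≤q fits-n fits-m))
  ... | _ | _ | _ | _ | _ = nothing
  spiders : ℕ → Maybe (UpperBound n m k)
  spiders zero    = nothing
  spiders (suc q) = spider? (n + m ∸ k ∸ suc q) (suc q) <∣> spiders q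
  twoColumns : Maybe (UpperBound n m k)
  twoColumns with 2 ≤? n | 2 ≤? m | n * 2 ≤? k
  ... | yes 2≤n | yes 2≤m | yes small =
    just (upperBound-mono small (firstColumns-upperBound 2 ≤-refl 2≤m (+-monoʳ-≤ 2 2≤n)))
  ... | _ | _ | _ = nothing
  crossing : Maybe (UpperBound n m k)
  crossing with n ≟ℕ 3 | m ≟ℕ 3 | 5 ≤? k
  ... | yes refl | yes refl | yes small = just (upperBound-mono small cross-upperBound)
  ... | _ | _ | _ = nothing

SmallCase : ℕ → ℕ → Set
SmallCase n m = 1 ≤ n → n ≤ m → m ≤ (5 * n ∸ 4) / 3 →
  (m % 8 ≡ (3 * n + 4) % 8 → T (is-just (construction? n m ((3 * (n + m) + 3) / 4 + 1))))
  × (¬ (m % 8 ≡ (3 * n + 4) % 8) → T (is-just (construction? n m ((3 * (n + m) + 3) / 4))))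

smallCase? : ∀ n m → Dec (SmallCase n m)
smallCase? n m = 1 ≤? n →-dec n ≤? m →-dec m ≤? (5 * n ∸ 4) / 3 →-dec
  (m % 8 ≟ℕ (3 * n + 4) % 8 →-dec T? _) ×-dec (¬? (m % 8 ≟ℕ (3 * n + 4) % 8) →-dec T? _)

smallCases : ∀ n m → n < 11 → SmallCase n m
smallCases n m n<11 with m <? 16
... | yes m<16 = subst₂ SmallCase (toℕ-fromℕ< n<11) (toℕ-fromℕ< m<16) (table (fromℕ< n<11) (fromℕ< m<16))
  where
  table : ∀ (i : Fin 11) (j : Fin 16) → SmallCase (toℕ i) (toℕ j)
  table = toWitness {a? = all? λ i → all? λ j → smallCase? (toℕ i) (toℕ j)} tt
... | no  m≮16 = λ _ _ m≤ → contradiction (s≤s (≤-trans m≤ (/-monoˡ-≤ 3 (∸-monoˡ-≤ 4 (*-monoʳ-≤ 5 (s≤s⁻¹ n<11)))))) m≮16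

m≤⌊x/3⌋⇒3m≤x : ∀ m x → m ≤ x / 3 → 3 * m ≤ x
m≤⌊x/3⌋⇒3m≤x m x m≤ = ≤-trans (≤-reflexive (*-comm 3 m)) (≤-trans (*-monoˡ-≤ 3 m≤) (m/n*n≤m x 3))

⌊x/3⌋<m⇒x<3m : ∀ m x → x / 3 < m → x < 3 * m
⌊x/3⌋<m⇒x<3m m x x/3<m = begin-strict
  x                    ≡⟨ m≡m%n+[m/n]*n x 3 ⟩
  x % 3 + x / 3 * 3    <⟨ +-monoˡ-< (x / 3 * 3) (m%n<n x 3) ⟩
  3 + x / 3 * 3        ≡⟨ *-comm (suc (x / 3)) 3 ⟩
  3 * suc (x / 3)      ≤⟨ *-monoʳ-≤ 3 x/3<m ⟩
  3 * m                ∎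
  where open ≤-Reasoning

m≤⌊[5n∸4]/3⌋⇒3m+4≤5n : ∀ n m → 1 ≤ n → m ≤ (5 * n ∸ 4) / 3 → 3 * m + 4 ≤ 5 * n
m≤⌊[5n∸4]/3⌋⇒3m+4≤5n n m 1≤n m≤ = ≤-trans (+-monoˡ-≤ 4 (m≤⌊x/3⌋⇒3m≤x m (5 * n ∸ 4) m≤))
  (≤-reflexive (m∸n+n≡m (≤-trans (s≤s (s≤s (s≤s (s≤s z≤n)))) (*-monoʳ-≤ 5 1≤n))))

⌊[5n∸4]/3⌋<m⇒5n≤3m+3 : ∀ n m → (5 * n ∸ 4) / 3 + 1 ≤ m → 5 * n ≤ 3 * m + 3
⌊[5n∸4]/3⌋<m⇒5n≤3m+3 n m lt = begin
  5 * n                ≤⟨ m≤n+m∸n (5 * n) 4 ⟩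
  3 + suc (5 * n ∸ 4)  ≤⟨ +-monoʳ-≤ 3 (⌊x/3⌋<m⇒x<3m m (5 * n ∸ 4) (subst (_≤ m) (+-comm _ 1) lt)) ⟩
  3 + 3 * m            ≡⟨ +-comm 3 (3 * m) ⟩
  3 * m + 3            ∎
  where open ≤-Reasoning

upperBound-⌈3[n+m]/4⌉+1 : ∀ n m → 1 ≤ n → n ≤ m → m ≤ (5 * n ∸ 4) / 3 → m % 8 ≡ (3 * n + 4) % 8 →
  UpperBound n m ((3 * (n + m) + 3) / 4 + 1)
upperBound-⌈3[n+m]/4⌉+1 n m 1≤n n≤m m≤ m≡ with 11 ≤? n
... | yes 11≤n = upperBound-large-⌈3[n+m]/4⌉+1 n m 11≤n n≤m (m≤⌊[5n∸4]/3⌋⇒3m+4≤5n n m 1≤n m≤)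
... | no  n≱11 = to-witness-T _ (proj₁ (smallCases n m (≰⇒> n≱11) 1≤n n≤m m≤) m≡)

upperBound-⌈3[n+m]/4⌉ : ∀ n m → 1 ≤ n → n ≤ m → m ≤ (5 * n ∸ 4) / 3 → ¬ (m % 8 ≡ (3 * n + 4) % 8) →
  UpperBound n m ((3 * (n + m) + 3) / 4)
upperBound-⌈3[n+m]/4⌉ n m 1≤n n≤m m≤ m≢ with 11 ≤? n
... | yes 11≤n = upperBound-large-⌈3[n+m]/4⌉ n m 11≤n n≤m (m≤⌊[5n∸4]/3⌋⇒3m+4≤5n n m 1≤n m≤) m≢
... | no  n≱11 = to-witness-T _ (proj₂ (smallCases n m (≰⇒> n≱11) 1≤n n≤m m≤) m≢)

n≤⌊[5n∸4]/3⌋ : ∀ n → 2 ≤ n → n ≤ (5 * n ∸ 4) / 3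
n≤⌊[5n∸4]/3⌋ n 2≤n = subst (_≤ (5 * n ∸ 4) / 3) (m*n/n≡m n 3) (/-monoˡ-≤ 3 (begin
  n * 3               ≡⟨ sym (m+n∸n≡m (n * 3) 4) ⟩
  n * 3 + 4 ∸ 4       ≤⟨ ∸-monoˡ-≤ 4 (+-monoʳ-≤ (n * 3) (*-monoʳ-≤ 2 2≤n)) ⟩
  n * 3 + 2 * n ∸ 4   ≡⟨ cong (_∸ 4) (n * 3 + 2 * n ≡ 5 * n ∋ solve (n ∷ [])) ⟩
  5 * n ∸ 4           ∎))
  where open ≤-Reasoning

[m+kn]/n≡m/n+k : ∀ m k n .{{_ : NonZero n}} → (m + k * n) / n ≡ m / n + k
[m+kn]/n≡m/n+k m k n = trans (+-distrib-/-∣ʳ m (divides-refl k)) (cong (m / n +_) (m*n/n≡m k n))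

⌈3[n+n]/4⌉≡⌈3n/2⌉ : ∀ n → (3 * (n + n) + 3) / 4 ≡ (3 * n + 1) / 2
⌈3[n+n]/4⌉≡⌈3n/2⌉ 0 = refl
⌈3[n+n]/4⌉≡⌈3n/2⌉ 1 = refl
⌈3[n+n]/4⌉≡⌈3n/2⌉ (suc (suc n)) = begin
  (3 * (suc (suc n) + suc (suc n)) + 3) / 4
    ≡⟨ cong (_/ 4) (3 * (suc (suc n) + suc (suc n)) + 3 ≡ 3 * (n + n) + 3 + 3 * 4 ∋ solve (n ∷ [])) ⟩
  (3 * (n + n) + 3 + 3 * 4) / 4            ≡⟨ [m+kn]/n≡m/n+k (3 * (n + n) + 3) 3 4 ⟩
  (3 * (n + n) + 3) / 4 + 3                ≡⟨ cong (_+ 3) (⌈3[n+n]/4⌉≡⌈3n/2⌉ n) ⟩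
  (3 * n + 1) / 2 + 3                      ≡⟨ sym ([m+kn]/n≡m/n+k (3 * n + 1) 3 2) ⟩
  (3 * n + 1 + 3 * 2) / 2                  ≡⟨ cong (_/ 2) (3 * n + 1 + 3 * 2 ≡ 3 * suc (suc n) + 1 ∋ solve (n ∷ [])) ⟩
  (3 * suc (suc n) + 1) / 2                ∎
  where open ≡-Reasoning

n%4≡2⇔n≡3n+4[mod8] : ∀ n → (n % 4 ≡ 2) ⇔ (n % 8 ≡ (3 * n + 4) % 8)
n%4≡2⇔n≡3n+4[mod8] n = subst₂ (λ a b → (a ≡ 2) ⇔ (n % 8 ≡ b))
  (m∣n⇒o%n%m≡o%m 4 8 n (divides 2 refl))
  (trans (residue-shift (n % 8) (n / 8)) (cong (λ x → (3 * x + 4) % 8) (sym (m≡m%n+[m/n]*n n 8))))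
  (residues (n % 8) (m%n<n n 8))
  where
  residue-shift : ∀ i w → (3 * i + 4) % 8 ≡ (3 * (i + w * 8) + 4) % 8
  residue-shift i w = sym (trans (cong (_% 8) (3 * (i + w * 8) + 4 ≡ 3 * i + 4 + 3 * w * 8 ∋ solve (i ∷ w ∷ [])))
                                 ([m+kn]%n≡m%n (3 * i + 4) (3 * w) 8))
  residues : ∀ i → i < 8 → (i % 4 ≡ 2) ⇔ (i ≡ (3 * i + 4) % 8)
  residues 0 _ = mk⇔ (λ ()) (λ ())
  residues 1 _ = mk⇔ (λ ()) (λ ())
  residues 2 _ = mk⇔ (λ _ → refl) (λ _ → refl)
  residues 3 _ = mk⇔ (λ ()) (λ ())
  residues 4 _ = mk⇔ (λ ()) (λ ())
  residues 5 _ = mk⇔ (λ ()) (λ ())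
  residues 6 _ = mk⇔ (λ _ → refl) (λ _ → refl)
  residues 7 _ = mk⇔ (λ ()) (λ ())
  residues (suc (suc (suc (suc (suc (suc (suc (suc _)))))))) (s≤s (s≤s (s≤s (s≤s (s≤s (s≤s (s≤s (s≤s ()))))))))

gamma-single : ∀ m → 3 ≤ m → Gamma×2t 1 m 3
gamma-single (suc m) 3≤m = gamma-intro (firstColumns-upperBound 3 (s≤s (s≤s z≤n)) 3≤m ≤-refl) (lowerBound-single m)

gamma-2n : ∀ n m → 2 ≤ n → n ≤ m → (5 * n ∸ 4) / 3 + 1 ≤ m → Gamma×2t n m (2 * n)
gamma-2n n m 2≤n n≤m lt = gamma-intro
  (upperBound-mono (≤-reflexive (*-comm n 2)) (firstColumns-upperBound 2 ≤-refl (≤-trans 2≤n n≤m) (+-monoʳ-≤ 2 2≤n)))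
  (lowerBound-2n n≤m (⌊[5n∸4]/3⌋<m⇒5n≤3m+3 n m lt))

gamma-⌈3[n+m]/4⌉+1 : ∀ n m → 1 ≤ n → n ≤ m → m ≤ (5 * n ∸ 4) / 3 → m % 8 ≡ (3 * n + 4) % 8 →
  Gamma×2t n m ((3 * (n + m) + 3) / 4 + 1)
gamma-⌈3[n+m]/4⌉+1 n m 1≤n n≤m m≤ m≡ = gamma-intro (upperBound-⌈3[n+m]/4⌉+1 n m 1≤n n≤m m≤ m≡)
  (lowerBound-⌈3[n+m]/4⌉+1 n≤m (m≤⌊[5n∸4]/3⌋⇒3m+4≤5n n m 1≤n m≤) m≡)

gamma-⌈3[n+m]/4⌉ : ∀ n m → 1 ≤ n → n ≤ m → m ≤ (5 * n ∸ 4) / 3 → ¬ (m % 8 ≡ (3 * n + 4) % 8) →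
  Gamma×2t n m ((3 * (n + m) + 3) / 4)
gamma-⌈3[n+m]/4⌉ n m 1≤n n≤m m≤ m≢ = gamma-intro (upperBound-⌈3[n+m]/4⌉ n m 1≤n n≤m m≤ m≢)
  (lowerBound-⌈3[n+m]/4⌉ n≤m (m≤⌊[5n∸4]/3⌋⇒3m+4≤5n n m 1≤n m≤))

proposition1 : (∀ (n m : ℕ) → 1 ≤ n → n ≤ m → ¬ (n ≡ 1 × m ≤ 2) →
    (n ≡ 1 → 3 ≤ m → Gamma×2t n m 3)
    × (2 ≤ n → ((5 * n ∸ 4) / 3) + 1 ≤ m → Gamma×2t n m (2 * n))
    × (m ≤ (5 * n ∸ 4) / 3 → m % 8 ≡ (3 * n + 4) % 8 →
         Gamma×2t n m ((3 * (n + m) + 3) / 4 + 1))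
    × (2 ≤ n → m ≤ (5 * n ∸ 4) / 3 → ¬ (m % 8 ≡ (3 * n + 4) % 8) →
         Gamma×2t n m ((3 * (n + m) + 3) / 4)))
  × (∀ (n : ℕ) → 2 ≤ n →
    (n % 4 ≡ 2 → Gamma×2t n n ((3 * n + 1) / 2 + 1))
    × (¬ (n % 4 ≡ 2) → Gamma×2t n n ((3 * n + 1) / 2)))
proposition1 =
  (λ n m 1≤n n≤m _ →
      (λ { refl 3≤m → gamma-single m 3≤m })
    , (λ 2≤n lt → gamma-2n n m 2≤n n≤m lt)
    , (λ m≤ m≡ → gamma-⌈3[n+m]/4⌉+1 n m 1≤n n≤m m≤ m≡)
    , (λ 2≤n m≤ m≢ → gamma-⌈3[n+m]/4⌉ n m (≤-trans (s≤s z≤n) 2≤n) n≤m m≤ m≢))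
  , λ n 2≤n →
      let 1≤n = ≤-trans (s≤s z≤n) 2≤n
          n≤ = n≤⌊[5n∸4]/3⌋ n 2≤n
          residue = n%4≡2⇔n≡3n+4[mod8] n
      in (λ n%4≡2 → subst (λ k → Gamma×2t n n (k + 1)) (⌈3[n+n]/4⌉≡⌈3n/2⌉ n)
                      (gamma-⌈3[n+m]/4⌉+1 n n 1≤n ≤-refl n≤ (Equivalence.to residue n%4≡2)))
       , (λ n%4≢2 → subst (Gamma×2t n n) (⌈3[n+n]/4⌉≡⌈3n/2⌉ n)
                      (gamma-⌈3[n+m]/4⌉ n n 1≤n ≤-refl n≤ (n%4≢2 ∘ Equivalence.from residue)))
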